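{- For integers $n\geq 0$, $0\le m\le n$ and $0\le k\le n$, let $N(n,m,k)$ be the number of Boolean functions $f:\{0,1\}^n\to\{0,1\}$ with exactly $m$ essential variables and canalizing depth $k$, and let $C(n,k)$ be the number of Boolean functions $f:\{0,1\}^n\to\{0,1\}$ with canalizing depth $k$ (regardless of the number of essential variables). Then $$N(n,m,k) = \begin{cases} 0 & \text{if } m<k,\\ 2 & \text{if } m=k=0,\\ \binom{n}{m}N(m,m,k) & \text{if } k\leq m < n,\\ C(n,k) - \sum_{i=0}^{n-1} N(n,i,k) & \text{if } m=n. \end{cases}$$
   Context: Boolean functions are maps $f:\{0,1\}^n\to\{0,1\}$ in variables $x_1,\dots,x_n$. The function $f$ is essential in $x_i$ if there is $\mathbf{x}\in\{0,1\}^n$ with $f(\mathbf{x})\neq f(\mathbf{x}\oplus e_i)$, where $\oplus$ is addition mod 2 and $e_i$ the $i$th unit vector; such $x_i$ is an essential variable. A function is non-degenerate if it is essential in all its variables. A function $f$ is canalizing if there exist a variable $x_i$, a Boolean function $g$ of the remaining variables, and $a,b\in\{0,1\}$ such that $f=b$ whenever $x_i=a$ and $f=g$ whenever $x_i\neq a$, with $g\not\equiv b$ (so constant functions are not canalizing). For $1\le k\le n$, $f$ is $k$-canalizing with respect to a permutation $\sigma$ of $\{1,\dots,n\}$, inputs $a_1,\dots,a_k$ and outputs $b_1,\dots,b_k$ if: $f=b_1$ when $x_{\sigma(1)}=a_1$; $f=b_j$ when $x_{\sigma(1)}\ne a_1,\dots,x_{\sigma(j-1)}\neq a_{j-1}, x_{\sigma(j)}=a_j$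 for $2\le j\le k$; and $f=g$ when $x_{\sigma(1)}\ne a_1,\dots,x_{\sigma(k)}\neq a_k$, where $g=g(x_{\sigma(k+1)},\dots,x_{\sigma(n)})$ is a Boolean function in the remaining $n-k$ variables with $g\not\equiv b_k$. If moreover $g$ is not canalizing, $k$ is called the canalizing depth of $f$ (this is well defined). If $f$ is not canalizing, its canalizing depth is defined to be $0$. -}

module Defs where

open import Data.Nat using (ℕ; zero; suc; _+_; _≤_; _<_)
open import Data.Bool using (Bool; not)
open import Data.Fin using (Fin; zero; suc; _↑ˡ_; _↑ʳ_; cast)
open import Data.Fin.Subset using (Subset; _∈_; ∣_∣)
open import Data.Fin.Permutation using (Permutation′; _⟨$⟩ʳ_)
open import Data.Vec using (Vec; lookup; tabulate; removeAt; _[_]%=_)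
open import Data.Product using (Σ; Σ-syntax; ∃; ∃-syntax; _×_; _,_)
open import Data.Empty using (⊥)
open import Relation.Nullary using (¬_)
open import Relation.Binary.PropositionalEquality using (_≡_; _≢_)

-- Boolean functions in n variables x = (x_1,...,x_n) (index i : Fin n is x_{i+1})
BF : ℕ → Set
BF n = Vec Bool n → Bool

_≗ᴮ_ : ∀ {n} → BF n → BF n → Set
f ≗ᴮ g = ∀ x → f x ≡ g x

Essential : ∀ {n} → BF n → Fin n → Set
Essential f i = ∃[ x ] (f x ≢ f (x [ i ]%= not))

NumEssential : ∀ {n} → BF n → ℕ → Set
NumEssential {n} f m =
  Σ[ S ∈ Subset n ] (∣ S ∣ ≡ m × (∀ i → (i ∈ S → Essential f i) × (Essential f i → i ∈ S)))

-- canalizing (constant functions, in particular all functions of 0 variables, are not)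
Canalizing : ∀ {n} → BF n → Set
Canalizing {zero} f = ⊥
Canalizing {suc n} f =
  Σ[ i ∈ Fin (suc n) ] Σ[ g ∈ BF n ] Σ[ a ∈ Bool ] Σ[ b ∈ Bool ]
    ((∀ x → lookup x i ≡ a → f x ≡ b)
    × (∀ x → lookup x i ≢ a → f x ≡ g (removeAt x i))
    × (∃[ y ] (g y ≢ b)))

-- f (in k + r variables, written n with k + r ≡ n) is k-canalizing w.r.t. σ, inputs a,
-- outputs b, with remaining function g in x_{σ(k+1)},...,x_{σ(n)} satisfying P.
-- Here σ(j) for j = 1..k is σ (inject j), and for j = k+1..n is σ (raise k j').
KCanalizingWith : (∀ {r} → BF r → Set) → ∀ {n} → (k : ℕ) → BF n → Set
KCanalizingWith P {n} k f =
  Σ[ r ∈ ℕ ] Σ[ eq ∈ k + r ≡ n ] Σ[ σ ∈ Permutation′ n ]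
  Σ[ a ∈ (Fin k → Bool) ] Σ[ b ∈ (Fin k → Bool) ] Σ[ g ∈ BF r ]
    let vσ : Fin k → Fin n
        vσ j = σ ⟨$⟩ʳ cast eq (j ↑ˡ r)
        rest : Vec Bool n → Vec Bool r
        rest x = tabulate (λ j → lookup x (σ ⟨$⟩ʳ cast eq (k ↑ʳ j)))
    in (∀ x (j : Fin k) → (∀ (j' : Fin k) → Data.Fin._<_ j' j → lookup x (vσ j') ≢ a j')
                       → lookup x (vσ j) ≡ a j → f x ≡ b j)
     × (∀ x → (∀ (j : Fin k) → lookup x (vσ j) ≢ a j) → f x ≡ g (rest x))
     × (∀ (last : Fin k) → Data.Fin.toℕ last ≡ Data.Nat.pred k → ∃[ y ] (g y ≢ b last))
     × P g

CanalizingDepth : ∀ {n} → BF n → ℕ → Set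
CanalizingDepth f zero = ¬ Canalizing f
CanalizingDepth f (suc k) = KCanalizingWith (λ g → ¬ Canalizing g) (suc k) f

Count : (n : ℕ) → (BF n → Set) → ℕ → Set
Count n P c =
  Σ[ L ∈ Vec (BF n) c ]
    ((∀ i → P (lookup L i))
    × (∀ i j → lookup L i ≗ᴮ lookup L j → i ≡ j)
    × (∀ f → P f → ∃[ i ] (f ≗ᴮ lookup L i)))

-- Canalizing depth has a recursive description: f has depth k + 1 iff for some
-- variable x_i and input a, x_i = a forces the value b of f and the restriction of
-- f to x_i = not a is a function, not constantly b, of depth k; depth 0 means not
-- canalizing.  This description is invariant under renaming the variables along an
-- injection, in particular under adding or deleting an inessential variable.
-- Hence a canalizing variable is essential, so depth k needs k essential variables;
-- a function without essential variables is one of the two constants, which have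
-- depth 0; and among the functions with m essential variables whose first j
-- variables are essential, splitting on whether x_j is essential (and deleting it
-- when it is not) gives Pascal's rule, whence N(n,m,k) = C(n,m) N(m,m,k).  Finally
-- C(n,k) is the sum of N(n,i,k) over the number i ≤ n of essential variables.

module Submission where

open import Defs
open import Data.Nat using (ℕ; zero; suc; _≤_; _<_; _*_; _∸_; _+_; z≤n; s≤s; _≟_)
open import Data.Nat.Properties
  using (suc-injective; ≤-refl; ≤-reflexive; ≤-antisym; ≤-pred; ≤∧≢⇒<; <⇒≢; <⇒≱; m≤n⇒m≤1+n;
         m<n⇒m<1+n; n≤0⇒n≡0; n≮0; n≮n; m+n≮n; m≤n+m; +-comm; +-suc; +-identityʳ; m+n∸m≡n;
         *-distribʳ-+; module ≤-Reasoning)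
open import Data.Nat.Combinatorics using (_C_; nCk+nC[k+1]≡[n+1]C[k+1])
open import Data.Nat.ListAction using (sum)
open import Data.Nat.ListAction.Properties using (sum-++)
open import Data.Bool using (Bool; true; false; not)
open import Data.Bool.Properties using (not-involutive; ¬-not; not-¬) renaming (_≟_ to _≟ᵇ_)
open import Data.Fin as Fin using (Fin; zero; suc; toℕ; punchIn; punchOut; cast; _↑ˡ_; _↑ʳ_; lift; fromℕ<)
open import Data.Fin.Properties
  using (toℕ-injective; toℕ-cast; toℕ-fromℕ<; cast-is-id; ↑ʳ-injective; lift-injective; injective⇒≤;
         punchIn-punchOut; punchInᵢ≢i; punchIn-injective; punchOut-injective; any?)
  renaming (_≟_ to _≟ᶠ_; suc-injective to Fin-suc-injective)
open import Data.Fin.Permutation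
  using (Permutation′; _⟨$⟩ʳ_; remove; insert; insert-remove; insert-punchIn) renaming (id to idₚ)
open import Data.Fin.Subset using (Subset; ∣_∣; _∈_; _⊆_) renaming (⊥ to ∅)
open import Data.Fin.Subset.Properties using (∣p∣≤n; ∣⊥∣≡0; ∣p∣≡n⇒p≡⊤; p⊆q⇒∣p∣≤∣q∣; ⊆-antisym)
open import Data.Vec using (Vec; []; _∷_; lookup; tabulate; replicate; insertAt; removeAt; updateAt)
open import Data.Vec.Properties
  using (lookup∘tabulate; tabulate∘lookup; tabulate-cong; lookup-replicate; insertAt-lookup; insertAt-punchIn;
         insertAt-removeAt; removeAt-insertAt; lookup∘updateAt; lookup∘updateAt′; []=⇒lookup; lookup⇒[]=)
import Data.Vec.Functional as Vector
open import Data.List using ([_]; _++_; map; upTo)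
open import Data.List.Properties using (upTo-∷ʳ; map-++)
open import Data.Product using (Σ-syntax; ∃; ∃₂; ∃-syntax; _×_; _,_; proj₁; proj₂)
open import Data.Product.Function.NonDependent.Propositional using (_×-⇔_)
open import Data.Sum using (_⊎_; inj₁; inj₂; swap)
open import Data.Empty using (⊥; ⊥-elim)
open import Data.Unit using (⊤)
open import Function using (_∘_; id)
open import Function.Definitions using (Injective)
open import Function.Bundles using (_⇔_; mk⇔; Injection; module Equivalence)
open import Function.Construct.Identity using (⇔-id)
open import Function.Properties.Equivalence using () renaming (trans to ⇔-trans; sym to ⇔-sym)
open import Function.Properties.Inverse using (↔⇒↣)
open import Function.Related.TypeIsomorphisms using (¬-cong-⇔)
open import Relation.Nullary using (¬_; Dec; yes; no; does)
open import Relation.Nullary.Decidable using (map′; _⊎-dec_; ¬?; does-⇔; dec-false)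
open import Relation.Binary.PropositionalEquality using (_≡_; _≢_; refl; sym; trans; cong; cong₂; subst; module ≡-Reasoning)

open Equivalence using (to; from)

private variable
  A : Set
  k m n r : ℕ

-- Vectors and selections of coordinates
lookup-ext : {xs ys : Vec A n} → (∀ i → lookup xs i ≡ lookup ys i) → xs ≡ ys
lookup-ext {xs = xs} {ys} eq = begin
  xs                  ≡⟨ tabulate∘lookup xs ⟨
  tabulate (lookup xs) ≡⟨ tabulate-cong eq ⟩
  tabulate (lookup ys) ≡⟨ tabulate∘lookup ys ⟩
  ys                  ∎
  where open ≡-Reasoning

select : (Fin m → Fin n) → Vec A n → Vec A m
select ρ x = tabulate (lookup x ∘ ρ)

lookup-select : (ρ : Fin m → Fin n) (x : Vec A n) (j : Fin m) → lookup (select ρ x) j ≡ lookup x (ρ j)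
lookup-select ρ x = lookup∘tabulate (lookup x ∘ ρ)

select-id : (x : Vec A n) → select id x ≡ x
select-id = tabulate∘lookup

lookup-removeAt : (x : Vec A (suc n)) (i : Fin (suc n)) (j : Fin n) → lookup (removeAt x i) j ≡ lookup x (punchIn i j)
lookup-removeAt (x ∷ xs) zero j = refl
lookup-removeAt (x ∷ y ∷ xs) (suc i) zero = refl
lookup-removeAt (x ∷ y ∷ xs) (suc i) (suc j) = lookup-removeAt (y ∷ xs) i j

removeAt≡select : (x : Vec A (suc n)) (i : Fin (suc n)) → removeAt x i ≡ select (punchIn i) x
removeAt≡select x i = lookup-ext λ j → trans (lookup-removeAt x i j) (sym (lookup-select (punchIn i) x j))

select-punchIn-insertAt : (y : Vec A n) (i : Fin (suc n)) (c : A) → select (punchIn i) (insertAt y i c) ≡ y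
select-punchIn-insertAt y i c = trans (sym (removeAt≡select (insertAt y i c) i)) (removeAt-insertAt y i c)

insertAt-select-punchIn : (x : Vec A (suc n)) (i : Fin (suc n)) → insertAt (select (punchIn i) x) i (lookup x i) ≡ x
insertAt-select-punchIn x i =
  trans (cong (λ y → insertAt y i (lookup x i)) (sym (removeAt≡select x i))) (insertAt-removeAt x i)

insertAt-unique : (v : Vec A (suc n)) (i : Fin (suc n)) {w : Vec A n} {c : A} →
                  select (punchIn i) v ≡ w → lookup v i ≡ c → v ≡ insertAt w i c
insertAt-unique v i refl refl = sym (insertAt-select-punchIn v i)

insertAt-updateAt : (y : Vec A n) (i : Fin (suc n)) (j : Fin n) (g : A → A) (c : A) →
                    insertAt (updateAt y j g) i c ≡ updateAt (insertAt y i c) (punchIn i j) g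
insertAt-updateAt y zero j g c = refl
insertAt-updateAt (v ∷ y) (suc i) zero g c = refl
insertAt-updateAt (v ∷ y) (suc i) (suc j) g c = cong (v ∷_) (insertAt-updateAt y i j g c)

lookup-insertAt-≢ : (y : Vec A n) {i t : Fin (suc n)} (c : A) (i≢t : i ≢ t) →
                    lookup (insertAt y i c) t ≡ lookup y (punchOut i≢t)
lookup-insertAt-≢ y {i} c i≢t =
  trans (cong (lookup (insertAt y i c)) (sym (punchIn-punchOut i≢t))) (insertAt-punchIn y i c _)

lookup-insertAt-not : (y : Vec Bool n) (i : Fin (suc n)) (a : Bool) → lookup (insertAt y i (not a)) i ≢ a
lookup-insertAt-not y i a e = not-¬ e (insertAt-lookup y i (not a))

module _ {ρ : Fin m → Fin n} {i : Fin n} (outside : ∀ j → ρ j ≢ i) where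

  select-updateAt-outside : (x : Vec A n) (g : A → A) → select ρ (updateAt x i g) ≡ select ρ x
  select-updateAt-outside x g = tabulate-cong λ j → lookup∘updateAt′ (ρ j) i (outside j) x

module _ {ρ : Fin m → Fin (suc n)} {i : Fin (suc n)} (outside : ∀ j → ρ j ≢ i) where

  select-insertAt-outside : (y : Vec A n) (c c′ : A) → select ρ (insertAt y i c) ≡ select ρ (insertAt y i c′)
  select-insertAt-outside y c c′ = tabulate-cong λ j →
    trans (lookup-insertAt-≢ y c (outside j ∘ sym)) (sym (lookup-insertAt-≢ y c′ (outside j ∘ sym)))

ρ≢ρ∘punchIn : {ρ : Fin (suc m) → Fin (suc n)} → Injective _≡_ _≡_ ρ → ∀ i j → ρ i ≢ ρ (punchIn i j)
ρ≢ρ∘punchIn ρ-inj i j = punchInᵢ≢i i j ∘ sym ∘ ρ-inj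

puncture : (ρ : Fin (suc m) → Fin (suc n)) → Injective _≡_ _≡_ ρ → Fin (suc m) → Fin m → Fin n
puncture ρ ρ-inj i j = punchOut (ρ≢ρ∘punchIn ρ-inj i j)

module _ (ρ : Fin (suc m) → Fin (suc n)) (ρ-inj : Injective _≡_ _≡_ ρ) (i : Fin (suc m)) where

  puncture-injective : Injective _≡_ _≡_ (puncture ρ ρ-inj i)
  puncture-injective {a} {b} =
    punchIn-injective i a b ∘ ρ-inj ∘ punchOut-injective (ρ≢ρ∘punchIn ρ-inj i a) (ρ≢ρ∘punchIn ρ-inj i b)

  select-insertAt : (y : Vec A n) (c : A) → select ρ (insertAt y (ρ i) c) ≡ insertAt (select (puncture ρ ρ-inj i) y) i c
  select-insertAt {A = A} y c = insertAt-unique (select ρ x) i (lookup-ext off-i) at-i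
    where
    x : Vec A (suc n)
    x = insertAt y (ρ i) c
    at-i : lookup (select ρ x) i ≡ c
    at-i = trans (lookup-select ρ x i) (insertAt-lookup y (ρ i) c)
    off-i : ∀ j → lookup (select (punchIn i) (select ρ x)) j ≡ lookup (select (puncture ρ ρ-inj i) y) j
    off-i j = begin
      lookup (select (punchIn i) (select ρ x)) j ≡⟨ lookup-select (punchIn i) (select ρ x) j ⟩
      lookup (select ρ x) (punchIn i j)          ≡⟨ lookup-select ρ x (punchIn i j) ⟩
      lookup x (ρ (punchIn i j))                 ≡⟨ lookup-insertAt-≢ y c (ρ≢ρ∘punchIn ρ-inj i j) ⟩
      lookup y (puncture ρ ρ-inj i j)            ≡⟨ lookup-select (puncture ρ ρ-inj i) y j ⟨
      lookup (select (puncture ρ ρ-inj i) y) j   ∎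
      where open ≡-Reasoning

select-surjective : {ρ : Fin m → Fin n} → Injective _≡_ _≡_ ρ → (z : Vec Bool m) → ∃[ x ] select ρ x ≡ z
select-surjective {n = n} ρ-inj [] = replicate n false , refl
select-surjective {n = zero} {ρ = ρ} ρ-inj (c ∷ z) with ρ zero
... | ()
select-surjective {n = suc n} {ρ = ρ} ρ-inj (c ∷ z) with select-surjective (puncture-injective ρ ρ-inj zero) z
... | x , refl = insertAt x (ρ zero) c , select-insertAt ρ ρ-inj zero x c

module _ {ρ : Fin m → Fin n} (ρ-inj : Injective _≡_ _≡_ ρ) where

  select-updateAt : (x : Vec A n) (t : Fin m) (g : A → A) → select ρ (updateAt x (ρ t) g) ≡ updateAt (select ρ x) t g
  select-updateAt x t g = lookup-ext pointwise
    where
    pointwise : ∀ j → lookup (select ρ (updateAt x (ρ t) g)) j ≡ lookup (updateAt (select ρ x) t g) j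
    pointwise j with j ≟ᶠ t
    ... | yes refl = begin
      lookup (select ρ (updateAt x (ρ j) g)) j ≡⟨ lookup-select ρ (updateAt x (ρ j) g) j ⟩
      lookup (updateAt x (ρ j) g) (ρ j)        ≡⟨ lookup∘updateAt (ρ j) x ⟩
      g (lookup x (ρ j))                       ≡⟨ cong g (lookup-select ρ x j) ⟨
      g (lookup (select ρ x) j)                ≡⟨ lookup∘updateAt j (select ρ x) ⟨
      lookup (updateAt (select ρ x) j g) j     ∎
      where open ≡-Reasoning
    ... | no j≢t = begin
      lookup (select ρ (updateAt x (ρ t) g)) j ≡⟨ lookup-select ρ (updateAt x (ρ t) g) j ⟩
      lookup (updateAt x (ρ t) g) (ρ j)        ≡⟨ lookup∘updateAt′ (ρ j) (ρ t) (j≢t ∘ ρ-inj) x ⟩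
      lookup x (ρ j)                           ≡⟨ lookup-select ρ x j ⟨
      lookup (select ρ x) j                    ≡⟨ lookup∘updateAt′ j t j≢t (select ρ x) ⟨
      lookup (updateAt (select ρ x) t g) j     ∎
      where open ≡-Reasoning

∣insertAt∣ : (S : Subset n) (i : Fin (suc n)) (b : Bool) → ∣ insertAt S i b ∣ ≡ ∣ b ∷ S ∣
∣insertAt∣ S zero b = refl
∣insertAt∣ (s ∷ S) (suc i) b with ∣insertAt∣ S i b
... | eq with s | b
...   | true  | true  = cong suc eq
...   | true  | false = cong suc eq
...   | false | true  = eq
...   | false | false = eq

∣removeAt∣ : (S : Subset (suc n)) (i : Fin (suc n)) → ∣ S ∣ ≡ ∣ lookup S i ∷ removeAt S i ∣
∣removeAt∣ S i = trans (cong ∣_∣ (sym (insertAt-removeAt S i))) (∣insertAt∣ (removeAt S i) i (lookup S i))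

∣∣-mono : (S T : Subset n) → (∀ i → lookup S i ≡ true → lookup T i ≡ true) → ∣ S ∣ ≤ ∣ T ∣
∣∣-mono S T S⊆T = p⊆q⇒∣p∣≤∣q∣ {p = S} {q = T} λ {i} i∈S → lookup⇒[]= i T (S⊆T i ([]=⇒lookup i∈S))

∣∣-prefix : (S : Subset n) (j : ℕ) → j ≤ n → (∀ t → toℕ t < j → lookup S t ≡ true) → j ≤ ∣ S ∣
∣∣-prefix S zero _ _ = z≤n
∣∣-prefix (true ∷ S) (suc j) (s≤s j≤n) prefix = s≤s (∣∣-prefix S j j≤n λ t t<j → prefix (suc t) (s≤s t<j))
∣∣-prefix (false ∷ S) (suc j) _ prefix with prefix zero (s≤s z≤n)
... | ()

-- Canalization, recursively, and its invariance under renaming variables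
restrict : BF (suc n) → Fin (suc n) → Bool → BF n
restrict f i c y = f (insertAt y i c)

Forces : BF n → Fin n → Bool → Bool → Set
Forces f i a b = ∀ x → lookup x i ≡ a → f x ≡ b

_≢const_ : BF n → Bool → Set
g ≢const b = ∃[ y ] g y ≢ b

CanalizesAt : BF (suc n) → Fin (suc n) → Bool → Bool → Set
CanalizesAt f i a b = Forces f i a b × restrict f i (not a) ≢const b

-- The paper's subfunction g is the restriction of f to x_i = not a.  Unlike
-- Defs.KCanalizingWith, g ≢ b is required at every layer, not only the innermost;
-- this is harmless since canalizing functions are never constant (canalization-≢const).
Canalization : (∀ {n} → BF n → Set) → ∀ {n} → BF n → Set
Canalization P {zero} f = ⊥
Canalization P {suc n} f =
  Σ[ i ∈ Fin (suc n) ] Σ[ a ∈ Bool ] Σ[ b ∈ Bool ] CanalizesAt f i a b × P (restrict f i (not a))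

Canalizing′ : BF n → Set
Canalizing′ = Canalization (λ _ → ⊤)

Depth : BF n → ℕ → Set
Depth f zero = ¬ Canalizing′ f
Depth f (suc k) = Canalization (λ g → Depth g k) f

-- f ≗ᴮ (h ∘ select ρ) says that f depends only on the variables in the image of ρ, through h.
SelectInvariant : (∀ {n} → BF n → Set) → Set
SelectInvariant P = ∀ {m n} {ρ : Fin m → Fin n} {f : BF n} {h : BF m} →
  Injective _≡_ _≡_ ρ → f ≗ᴮ (h ∘ select ρ) → P f ⇔ P h

≢const-invariant : ∀ b → SelectInvariant (_≢const b)
≢const-invariant b {ρ = ρ} {f} {h} ρ-inj f≗h∘ρ = mk⇔ forward backward
  where
  forward : f ≢const b → h ≢const b
  forward (x , fx≢b) = select ρ x , fx≢b ∘ trans (f≗h∘ρ x)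
  backward : h ≢const b → f ≢const b
  backward (z , hz≢b) with select-surjective ρ-inj z
  ... | x , refl = x , hz≢b ∘ trans (sym (f≗h∘ρ x))

module _ {ρ : Fin m → Fin n} {f : BF n} {h : BF m}
         (ρ-inj : Injective _≡_ _≡_ ρ) (f≗h∘ρ : f ≗ᴮ (h ∘ select ρ)) where

  forces-select : ∀ i a b → Forces f (ρ i) a b ⇔ Forces h i a b
  forces-select i a b = mk⇔ forward backward
    where
    forward : Forces f (ρ i) a b → Forces h i a b
    forward F z zᵢ≡a with select-surjective ρ-inj z
    ... | x , refl = trans (sym (f≗h∘ρ x)) (F x (trans (sym (lookup-select ρ x i)) zᵢ≡a))
    backward : Forces h i a b → Forces f (ρ i) a b
    backward F x xᵢ≡a = trans (f≗h∘ρ x) (F (select ρ x) (trans (lookup-select ρ x i) xᵢ≡a))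

module _ {ρ : Fin m → Fin (suc n)} {f : BF (suc n)} {h : BF m} (f≗h∘ρ : f ≗ᴮ (h ∘ select ρ)) where

  forces-outside : ∀ {i a b} → (∀ j → ρ j ≢ i) → Forces f i a b → ¬ (restrict f i (not a) ≢const b)
  forces-outside {i} {a} {b} outside F (y , ≢b) = ≢b (begin
    f (insertAt y i (not a))          ≡⟨ f≗h∘ρ _ ⟩
    h (select ρ (insertAt y i (not a))) ≡⟨ cong h (select-insertAt-outside outside y (not a) a) ⟩
    h (select ρ (insertAt y i a))     ≡⟨ f≗h∘ρ _ ⟨
    f (insertAt y i a)                ≡⟨ F _ (insertAt-lookup y i a) ⟩
    b                                 ∎)
    where open ≡-Reasoning

module _ {ρ : Fin (suc m) → Fin (suc n)} {f : BF (suc n)} {h : BF (suc m)}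
         (ρ-inj : Injective _≡_ _≡_ ρ) (f≗h∘ρ : f ≗ᴮ (h ∘ select ρ)) where

  restrict-select : ∀ i c → restrict f (ρ i) c ≗ᴮ (restrict h i c ∘ select (puncture ρ ρ-inj i))
  restrict-select i c y = trans (f≗h∘ρ _) (cong h (select-insertAt ρ ρ-inj i y c))

  canalizesAt-select : ∀ i a b → CanalizesAt f (ρ i) a b ⇔ CanalizesAt h i a b
  canalizesAt-select i a b =
    forces-select {h = h} ρ-inj f≗h∘ρ i a b ×-⇔
    ≢const-invariant b (puncture-injective ρ ρ-inj i) (restrict-select i (not a))

canalization-invariant : {P : ∀ {n} → BF n → Set} → SelectInvariant P → SelectInvariant (Canalization P)
canalization-invariant P-inv {zero} {zero} ρ-inj f≗h∘ρ = ⇔-id ⊥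
canalization-invariant P-inv {suc m} {zero} {ρ} ρ-inj f≗h∘ρ with ρ zero
... | ()
canalization-invariant {P} P-inv {zero} {suc n} {ρ} {f} {h} ρ-inj f≗h∘ρ = mk⇔ forward λ ()
  where
  forward : Canalization P f → ⊥
  forward (i , a , b , (F , ≢b) , _) = forces-outside {ρ = ρ} {h = h} f≗h∘ρ (λ ()) F ≢b
canalization-invariant {P} P-inv {suc m} {suc n} {ρ} {f} {h} ρ-inj f≗h∘ρ = mk⇔ forward backward
  where
  canalizesAt-inv : ∀ i a b → CanalizesAt f (ρ i) a b ⇔ CanalizesAt h i a b
  canalizesAt-inv = canalizesAt-select {h = h} ρ-inj f≗h∘ρ
  restrict-inv : ∀ i c → P (restrict f (ρ i) c) ⇔ P (restrict h i c)
  restrict-inv i c = P-inv (puncture-injective ρ ρ-inj i) (restrict-select {h = h} ρ-inj f≗h∘ρ i c)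
  forward : Canalization P f → Canalization P h
  forward (i , a , b , C , p) with any? (λ j → ρ j ≟ᶠ i)
  ... | yes (i′ , refl) = i′ , a , b , to (canalizesAt-inv i′ a b) C , to (restrict-inv i′ (not a)) p
  ... | no i∉ρ = ⊥-elim (forces-outside {h = h} f≗h∘ρ (λ j ρj≡i → i∉ρ (j , ρj≡i)) (proj₁ C) (proj₂ C))
  backward : Canalization P h → Canalization P f
  backward (i , a , b , C , p) = ρ i , a , b , from (canalizesAt-inv i a b) C , from (restrict-inv i (not a)) p

canalizing′-invariant : SelectInvariant Canalizing′
canalizing′-invariant = canalization-invariant (λ _ _ → ⇔-id ⊤)

depth-invariant : ∀ k → SelectInvariant (λ f → Depth f k)
depth-invariant zero ρ-inj f≗h∘ρ = ¬-cong-⇔ (canalizing′-invariant ρ-inj f≗h∘ρ)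
depth-invariant (suc k) = canalization-invariant {λ g → Depth g k} (depth-invariant k)

-- Agreement with the definitions of the paper
Forcing : (∀ {n} → BF n → Set) → BF (suc n) → Set
Forcing {n} Q f = Σ[ i ∈ Fin (suc n) ] Σ[ a ∈ Bool ] Σ[ b ∈ Bool ] Forces f i a b × Q (restrict f i (not a))

canalization-≢const : {P : ∀ {n} → BF n → Set} {f : BF n} → Canalization P f → ∀ b → f ≢const b
canalization-≢const {zero} ()
canalization-≢const {suc n} (i , a , b′ , (F , y , ≢b′) , _) b with b ≟ᵇ b′
... | yes refl = insertAt y i (not a) , ≢b′
... | no b≢b′ = insertAt y i a , λ fx≡b → b≢b′ (trans (sym fx≡b) (F _ (insertAt-lookup y i a)))

canalization⇔forcing : ∀ {Q : ∀ {n} → BF n → Set} {f : BF (suc n)} →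
  (∀ {m} {g : BF m} → Q g → ∀ b → g ≢const b) → Canalization Q f ⇔ Forcing Q f
canalization⇔forcing Q⇒≢const = mk⇔
  (λ (i , a , b , (F , _) , q) → i , a , b , F , q)
  (λ (i , a , b , F , q) → i , a , b , (F , Q⇒≢const q b) , q)

canalization-cong : ∀ {P Q : ∀ {n} → BF n → Set} {f : BF n} →
  (∀ {m} {g : BF m} → P g ⇔ Q g) → Canalization P f ⇔ Canalization Q f
canalization-cong {zero} P⇔Q = ⇔-id ⊥
canalization-cong {suc n} P⇔Q = mk⇔
  (λ (i , a , b , C , p) → i , a , b , C , to P⇔Q p)
  (λ (i , a , b , C , q) → i , a , b , C , from P⇔Q q)

forcing-cong : ∀ {P Q : ∀ {n} → BF n → Set} {f : BF (suc n)} →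
  (∀ {g : BF n} → P g ⇔ Q g) → Forcing P f ⇔ Forcing Q f
forcing-cong P⇔Q = mk⇔
  (λ (i , a , b , F , p) → i , a , b , F , to P⇔Q p)
  (λ (i , a , b , F , q) → i , a , b , F , from P⇔Q q)

restrict-removeAt : (f : BF (suc n)) {i : Fin (suc n)} {c : Bool} (x : Vec Bool (suc n)) →
                    lookup x i ≡ c → f x ≡ restrict f i c (removeAt x i)
restrict-removeAt f {i} x refl = cong f (sym (insertAt-removeAt x i))

canalizing⇔canalizing′ : {f : BF n} → Canalizing f ⇔ Canalizing′ f
canalizing⇔canalizing′ {zero} = ⇔-id ⊥
canalizing⇔canalizing′ {suc n} {f} = mk⇔ forward backward
  where
  forward : Canalizing f → Canalizing′ f
  forward (i , g , a , b , F , f≡g , y , gy≢b) = i , a , b , (F , y , gy≢b ∘ trans (sym restrict≡g)) , _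
    where
    restrict≡g : restrict f i (not a) y ≡ g y
    restrict≡g = trans (f≡g _ (lookup-insertAt-not y i a)) (cong g (removeAt-insertAt y i (not a)))
  backward : Canalizing′ f → Canalizing f
  backward (i , a , b , (F , ≢b) , _) =
    i , restrict f i (not a) , a , b , F , (λ x xᵢ≢a → restrict-removeAt f x (¬-not xᵢ≢a)) , ≢b

-- The canalizing variables x_σ(1), …, x_σ(k) and the remaining variables of Defs.KCanalizingWith.
leading : (σ : Permutation′ n) {k r : ℕ} → k + r ≡ n → Fin k → Fin n
leading σ {r = r} eq j = σ ⟨$⟩ʳ cast eq (j ↑ˡ r)

trailing : (σ : Permutation′ n) {k r : ℕ} → k + r ≡ n → Fin r → Fin n
trailing σ {k} eq j = σ ⟨$⟩ʳ cast eq (k ↑ʳ j)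

trailing-injective : (σ : Permutation′ n) {k r : ℕ} (eq : k + r ≡ n) → Injective _≡_ _≡_ (trailing σ eq)
trailing-injective σ {k} eq {a} {b} =
  ↑ʳ-injective k a b ∘ cast-injective ∘ Injection.injective (↔⇒↣ σ)
  where
  cast-injective : ∀ {s t} → cast eq s ≡ cast eq t → s ≡ t
  cast-injective {s} {t} e = toℕ-injective (trans (sym (toℕ-cast eq s)) (trans (cong toℕ e) (toℕ-cast eq t)))

OrderedForcing : BF n → (Fin k → Fin n) → (Fin k → Bool) → (Fin k → Bool) → Set
OrderedForcing {k = k} f v a b = ∀ x (j : Fin k) →
  (∀ (j′ : Fin k) → j′ Fin.< j → lookup x (v j′) ≢ a j′) → lookup x (v j) ≡ a j → f x ≡ b j

Remainder : BF n → (Fin k → Fin n) → (Fin k → Bool) → BF r → (Fin r → Fin n) → Set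
Remainder f v a g w = ∀ x → (∀ j → lookup x (v j) ≢ a j) → f x ≡ g (select w x)

-- Peeling off the first canalizing variable v zero; v′ and w′ are the remaining canalizing
-- and trailing variables, renumbered among the variables other than v zero.
module Peel {v : Fin (suc k) → Fin (suc n)} {v′ : Fin k → Fin n} {w : Fin r → Fin (suc n)} {w′ : Fin r → Fin n}
            (v-punchIn : ∀ t → v (suc t) ≡ punchIn (v zero) (v′ t))
            (w-punchIn : ∀ t → w t ≡ punchIn (v zero) (w′ t))
            {f : BF (suc n)} {a b : Fin (suc k) → Bool} where

  private
    i : Fin (suc n)
    i = v zero
    f′ : BF n
    f′ = restrict f i (not (a zero))

  shift-v : ∀ y t → lookup (insertAt y i (not (a zero))) (v (suc t)) ≡ lookup y (v′ t)
  shift-v y t = trans (cong (lookup (insertAt y i _)) (v-punchIn t)) (insertAt-punchIn y i _ (v′ t))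

  shift-w : ∀ y → select w (insertAt y i (not (a zero))) ≡ select w′ y
  shift-w y = tabulate-cong λ t →
    trans (cong (lookup (insertAt y i _)) (w-punchIn t)) (insertAt-punchIn y i _ (w′ t))

  decompose : ∀ x → lookup x i ≢ a zero → ∃[ y ] x ≡ insertAt y i (not (a zero))
  decompose x xᵢ≢a = select (punchIn i) x , insertAt-unique x i refl (¬-not xᵢ≢a)

  orderedForcing-peel :
    OrderedForcing f v a b ⇔ (Forces f i (a zero) (b zero) × OrderedForcing f′ v′ (a ∘ suc) (b ∘ suc))
  orderedForcing-peel = mk⇔ forward backward
    where
    forward : OrderedForcing f v a b → Forces f i (a zero) (b zero) × OrderedForcing f′ v′ (a ∘ suc) (b ∘ suc)
    forward H = (λ x → H x zero (λ _ ())) , λ y j earlier hit →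
      H (insertAt y i _) (suc j) (earlier′ y j earlier) (trans (shift-v y j) hit)
      where
      earlier′ : ∀ y j → (∀ j′ → j′ Fin.< j → lookup y (v′ j′) ≢ a (suc j′)) →
                 ∀ j′ → j′ Fin.< suc j → lookup (insertAt y i (not (a zero))) (v j′) ≢ a j′
      earlier′ y j earlier zero _ = lookup-insertAt-not y i (a zero)
      earlier′ y j earlier (suc j′) (s≤s j′<j) = earlier j′ j′<j ∘ trans (sym (shift-v y j′))
    backward : Forces f i (a zero) (b zero) × OrderedForcing f′ v′ (a ∘ suc) (b ∘ suc) → OrderedForcing f v a b
    backward (F , H′) x zero _ hit = F x hit
    backward (F , H′) x (suc j) earlier hit with decompose x (earlier zero (s≤s z≤n))
    ... | y , refl =
      H′ y j (λ j′ j′<j → earlier (suc j′) (s≤s j′<j) ∘ trans (shift-v y j′)) (trans (sym (shift-v y j)) hit)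

  remainder-peel : ∀ {g : BF r} → Remainder f v a g w ⇔ Remainder f′ v′ (a ∘ suc) g w′
  remainder-peel {g} = mk⇔ forward backward
    where
    forward : Remainder f v a g w → Remainder f′ v′ (a ∘ suc) g w′
    forward R y misses = trans (R (insertAt y i _) misses′) (cong g (shift-w y))
      where
      misses′ : ∀ j → lookup (insertAt y i (not (a zero))) (v j) ≢ a j
      misses′ zero = lookup-insertAt-not y i (a zero)
      misses′ (suc j) = misses j ∘ trans (sym (shift-v y j))
    backward : Remainder f′ v′ (a ∘ suc) g w′ → Remainder f v a g w
    backward R′ x misses with decompose x (misses zero)
    ... | y , refl = trans (R′ y (λ j → misses (suc j) ∘ trans (shift-v y j))) (cong g (sym (shift-w y)))

remove-zero-punchIn : (σ : Permutation′ (suc n)) (t : Fin n) →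
                      σ ⟨$⟩ʳ suc t ≡ punchIn (σ ⟨$⟩ʳ zero) (remove zero σ ⟨$⟩ʳ t)
remove-zero-punchIn σ t =
  trans (sym (insert-remove zero σ (suc t))) (insert-punchIn zero (σ ⟨$⟩ʳ zero) (remove zero σ) t)

module _ (P : ∀ {r} → BF r → Set) where

  kCanalizing-suc-suc⇔ : {f : BF (suc n)} →
    KCanalizingWith P (suc (suc k)) f ⇔ Forcing (λ g → KCanalizingWith P (suc k) g) f
  kCanalizing-suc-suc⇔ {n} {k} {f} = mk⇔ forward backward
    where
    forward : KCanalizingWith P (suc (suc k)) f → Forcing (λ g → KCanalizingWith P (suc k) g) f
    forward (r , refl , σ , a , b , g , H₁ , H₂ , H₃ , Pg) =
      σ ⟨$⟩ʳ zero , a zero , b zero , proj₁ (to orderedForcing-peel H₁) ,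
      r , refl , remove zero σ , a ∘ suc , b ∘ suc , g ,
      proj₂ (to orderedForcing-peel H₁) , to (remainder-peel {g = g}) H₂ , (λ last eq → H₃ (suc last) (cong suc eq)) , Pg
      where
      open Peel {v = leading σ {suc (suc k)} refl} {w = trailing σ {suc (suc k)} refl}
                (λ t → remove-zero-punchIn σ (cast refl (t ↑ˡ r)))
                (λ t → remove-zero-punchIn σ (cast refl (suc k ↑ʳ t))) {f} {a} {b}
    backward : Forcing (λ g → KCanalizingWith P (suc k) g) f → KCanalizingWith P (suc (suc k)) f
    backward (i , a₀ , b₀ , F , r , refl , σ′ , a′ , b′ , g , H₁′ , H₂′ , H₃′ , Pg) =
      r , refl , insert zero i σ′ , a₀ Vector.∷ a′ , b₀ Vector.∷ b′ , g ,
      from orderedForcing-peel (F , H₁′) , from (remainder-peel {g = g}) H₂′ , H₃ , Pg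
      where
      open Peel {v = leading (insert zero i σ′) {suc (suc k)} refl} {w = trailing (insert zero i σ′) {suc (suc k)} refl}
                (λ t → insert-punchIn zero i σ′ (cast refl (t ↑ˡ r)))
                (λ t → insert-punchIn zero i σ′ (cast refl (suc k ↑ʳ t)))
                {f} {a₀ Vector.∷ a′} {b₀ Vector.∷ b′}
      H₃ : ∀ last → toℕ last ≡ suc k → ∃[ y ] g y ≢ (b₀ Vector.∷ b′) last
      H₃ zero ()
      H₃ (suc last) eq = H₃′ last (suc-injective eq)

  kCanalizing-one⇔ : SelectInvariant P → {f : BF n} → KCanalizingWith P 1 f ⇔ Canalization P f
  kCanalizing-one⇔ {zero} P-inv = mk⇔ (λ { (_ , () , _) }) λ ()
  kCanalizing-one⇔ {suc n} P-inv {f} = mk⇔ forward backward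
    where
    forward : KCanalizingWith P 1 f → Canalization P f
    forward (.n , refl , σ , a , b , g , H₁ , H₂ , H₃ , Pg) =
      σ ⟨$⟩ʳ zero , a zero , b zero ,
      (proj₁ (to orderedForcing-peel H₁) , from (≢const-invariant (b zero) ρ-inj f′≗g∘ρ) (H₃ zero refl)) ,
      from (P-inv ρ-inj f′≗g∘ρ) Pg
      where
      open Peel {v = leading σ {1} refl} {w = trailing σ {1} refl}
                (λ t → remove-zero-punchIn σ (cast refl (t ↑ˡ n)))
                (λ t → remove-zero-punchIn σ (cast refl t)) {f} {a} {b}
      ρ-inj : Injective _≡_ _≡_ (trailing (remove zero σ) {0} refl)
      ρ-inj = trailing-injective (remove zero σ) refl
      f′≗g∘ρ : restrict f (σ ⟨$⟩ʳ zero) (not (a zero)) ≗ᴮ (g ∘ select (trailing (remove zero σ) {0} refl))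
      f′≗g∘ρ y = to (remainder-peel {g = g}) H₂ y λ ()
    backward : Canalization P f → KCanalizingWith P 1 f
    backward (i , a₀ , b₀ , (F , ≢b₀) , Pf′) =
      n , refl , insert zero i idₚ , (λ _ → a₀) , (λ _ → b₀) , f′ ,
      from orderedForcing-peel (F , λ _ ()) , from (remainder-peel {g = f′}) (λ y _ → cong f′ (sym (select-cast y))) ,
      (λ { zero refl → ≢b₀ }) , Pf′
      where
      f′ : BF n
      f′ = restrict f i (not a₀)
      open Peel {v = leading (insert zero i idₚ) {1} refl} {w = trailing (insert zero i idₚ) {1} refl}
                (λ t → insert-punchIn zero i idₚ (cast refl (t ↑ˡ n))) (λ t → insert-punchIn zero i idₚ (cast refl t))
                {f} {λ _ → a₀} {λ _ → b₀}
      select-cast : (y : Vec Bool n) → select (trailing idₚ {0} refl) y ≡ y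
      select-cast y = lookup-ext λ t → trans (lookup-select _ y t) (cong (lookup y) (cast-is-id refl t))

¬canalizing-invariant : SelectInvariant (λ f → ¬ Canalizing f)
¬canalizing-invariant ρ-inj f≗h∘ρ =
  ¬-cong-⇔ (⇔-trans canalizing⇔canalizing′
           (⇔-trans (canalizing′-invariant ρ-inj f≗h∘ρ) (⇔-sym canalizing⇔canalizing′)))

canalizingDepth⇔depth : ∀ k {f : BF n} → CanalizingDepth f k ⇔ Depth f k
canalizingDepth⇔depth zero = ¬-cong-⇔ canalizing⇔canalizing′
canalizingDepth⇔depth (suc zero) =
  ⇔-trans (kCanalizing-one⇔ _ ¬canalizing-invariant) (canalization-cong (¬-cong-⇔ canalizing⇔canalizing′))
canalizingDepth⇔depth {zero} (suc (suc k)) = mk⇔ (λ { (_ , () , _) }) λ ()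
canalizingDepth⇔depth {suc n} (suc (suc k)) =
  ⇔-trans (kCanalizing-suc-suc⇔ _)
  (⇔-trans (forcing-cong {P = λ g → CanalizingDepth g (suc k)} {Q = λ g → Depth g (suc k)}
                         (canalizingDepth⇔depth (suc k)))
           (⇔-sym (canalization⇔forcing {Q = λ g → Depth g (suc k)} (canalization-≢const {P = λ g → Depth g k}))))

-- Essential variables
∃-vec? : {P : Vec Bool n → Set} → (∀ x → Dec (P x)) → Dec (∃ P)
∃-vec? {zero} P? = map′ ([] ,_) (λ { ([] , p) → p }) (P? [])
∃-vec? {suc n} {P} P? = map′ join split (∃-vec? (P? ∘ (true ∷_)) ⊎-dec ∃-vec? (P? ∘ (false ∷_)))
  where
  join : ∃ (P ∘ (true ∷_)) ⊎ ∃ (P ∘ (false ∷_)) → ∃ P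
  join (inj₁ (x , p)) = true ∷ x , p
  join (inj₂ (x , p)) = false ∷ x , p
  split : ∃ P → ∃ (P ∘ (true ∷_)) ⊎ ∃ (P ∘ (false ∷_))
  split (true ∷ x , p) = inj₁ (x , p)
  split (false ∷ x , p) = inj₂ (x , p)

essential? : (f : BF n) (i : Fin n) → Dec (Essential f i)
essential? f i = ∃-vec? λ x → ¬? (f x ≟ᵇ f (updateAt x i not))

essentials : BF n → Subset n
essentials f = tabulate (does ∘ essential? f)

numEssential : BF n → ℕ
numEssential f = ∣ essentials f ∣

does≡true⇔ : {B : Set} (b? : Dec B) → does b? ≡ true ⇔ B
does≡true⇔ (yes b) = mk⇔ (λ _ → b) (λ _ → refl)
does≡true⇔ (no ¬b) = mk⇔ (λ ()) (⊥-elim ∘ ¬b)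

lookup-essentials : (f : BF n) (i : Fin n) → lookup (essentials f) i ≡ true ⇔ Essential f i
lookup-essentials f i = ⇔-trans (mk⇔ (trans (sym eq)) (trans eq)) (does≡true⇔ (essential? f i))
  where
  eq : lookup (essentials f) i ≡ does (essential? f i)
  eq = lookup∘tabulate (does ∘ essential? f) i

∈-essentials : (f : BF n) (i : Fin n) → i ∈ essentials f ⇔ Essential f i
∈-essentials f i = ⇔-trans (mk⇔ []=⇒lookup (lookup⇒[]= i (essentials f))) (lookup-essentials f i)

essentials-cong : {f g : BF n} → (∀ i → Essential f i ⇔ Essential g i) → essentials f ≡ essentials g
essentials-cong {f = f} {g} ess⇔ = tabulate-cong λ i → does-⇔ (ess⇔ i) (essential? f i) (essential? g i)

essential-cong : {f g : BF n} → f ≗ᴮ g → ∀ {i} → Essential f i → Essential g i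
essential-cong f≗g (x , fx≢) = x , λ gx≡ → fx≢ (trans (f≗g x) (trans gx≡ (sym (f≗g _))))

inessential-flip : {f : BF n} {i : Fin n} → ¬ Essential f i → ∀ x → f x ≡ f (updateAt x i not)
inessential-flip {f = f} {i} ¬ess x with f x ≟ᵇ f (updateAt x i not)
... | yes eq = eq
... | no neq = ⊥-elim (¬ess (x , neq))

module _ {ρ : Fin m → Fin n} (h : BF m) where

  essential-select : Injective _≡_ _≡_ ρ → ∀ t → Essential (h ∘ select ρ) (ρ t) ⇔ Essential h t
  essential-select ρ-inj t = mk⇔ forward backward
    where
    forward : Essential (h ∘ select ρ) (ρ t) → Essential h t
    forward (x , ≢) = select ρ x , λ eq → ≢ (trans eq (cong h (sym (select-updateAt ρ-inj x t not))))
    backward : Essential h t → Essential (h ∘ select ρ) (ρ t)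
    backward (z , ≢) with select-surjective ρ-inj z
    ... | x , refl = x , λ eq → ≢ (trans eq (cong h (select-updateAt ρ-inj x t not)))

  essential-outside : ∀ {i} → (∀ j → ρ j ≢ i) → ¬ Essential (h ∘ select ρ) i
  essential-outside outside (x , ≢) = ≢ (cong h (sym (select-updateAt-outside outside x not)))

essential-restrict : (f : BF (suc n)) (i : Fin (suc n)) (c : Bool) {j : Fin n} →
                     Essential (restrict f i c) j → Essential f (punchIn i j)
essential-restrict f i c {j} (y , ≢) = insertAt y i c , λ eq → ≢ (trans eq (cong f (sym (insertAt-updateAt y i j not c))))

canalizesAt-essential : {f : BF (suc n)} {i : Fin (suc n)} {a b : Bool} → CanalizesAt f i a b → Essential f i
canalizesAt-essential {f = f} {i} {a} {b} (F , y , ≢b) = insertAt y i (not a) , λ eq → ≢b (trans eq (F _ flipped))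
  where
  flipped : lookup (updateAt (insertAt y i (not a)) i not) i ≡ a
  flipped = trans (lookup∘updateAt i (insertAt y i (not a))) (trans (cong not (insertAt-lookup y i (not a))) (not-involutive a))

inessential-factors : {f : BF (suc n)} {p : Fin (suc n)} → ¬ Essential f p →
                      ∀ c → f ≗ᴮ (restrict f p c ∘ select (punchIn p))
inessential-factors {f = f} {p} ¬ess c x with lookup x p ≟ᵇ c
... | yes xₚ≡c = cong f (insertAt-unique x p refl xₚ≡c)
... | no xₚ≢c = trans (inessential-flip ¬ess x) (cong f (insertAt-unique (updateAt x p not) p unmoved flipped))
  where
  unmoved : select (punchIn p) (updateAt x p not) ≡ select (punchIn p) x
  unmoved = select-updateAt-outside (punchInᵢ≢i p) x not
  flipped : lookup (updateAt x p not) p ≡ c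
  flipped = trans (lookup∘updateAt p x) (trans (cong not (¬-not xₚ≢c)) (not-involutive c))

inessential⇒constant : {f : BF n} → (∀ i → ¬ Essential f i) → ∀ x y → f x ≡ f y
inessential⇒constant {zero} ¬ess [] [] = refl
inessential⇒constant {suc n} {f} ¬ess x y = begin
  f x                                    ≡⟨ factors x ⟩
  restrict f zero false (select suc x)   ≡⟨ inessential⇒constant ¬ess′ _ _ ⟩
  restrict f zero false (select suc y)   ≡⟨ factors y ⟨
  f y                                    ∎
  where
  open ≡-Reasoning
  factors : f ≗ᴮ (restrict f zero false ∘ select suc)
  factors = inessential-factors (¬ess zero) false
  ¬ess′ : ∀ j → ¬ Essential (restrict f zero false) j
  ¬ess′ j = ¬ess (suc j) ∘ essential-restrict f zero false

numEssential≤n : (f : BF n) → numEssential f ≤ n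
numEssential≤n f = ∣p∣≤n (essentials f)

numEssential-cong : {f g : BF n} → f ≗ᴮ g → numEssential f ≡ numEssential g
numEssential-cong f≗g = cong ∣_∣ (essentials-cong λ i → mk⇔ (essential-cong f≗g) (essential-cong (sym ∘ f≗g)))

numEssential-suc : {f : BF (suc n)} {i : Fin (suc n)} → Essential f i → numEssential f ≡ suc ∣ removeAt (essentials f) i ∣
numEssential-suc {f = f} {i} ess =
  trans (∣removeAt∣ (essentials f) i) (cong (λ b → ∣ b ∷ removeAt (essentials f) i ∣) (from (lookup-essentials f i) ess))

numEssential-restrict : (f : BF (suc n)) (i : Fin (suc n)) (c : Bool) →
                        numEssential (restrict f i c) ≤ ∣ removeAt (essentials f) i ∣
numEssential-restrict f i c = ∣∣-mono (essentials (restrict f i c)) (removeAt (essentials f) i) λ j ess →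
  trans (lookup-removeAt (essentials f) i j)
        (from (lookup-essentials f (punchIn i j)) (essential-restrict f i c (to (lookup-essentials (restrict f i c) j) ess)))

numEssential-dummy : (h : BF n) (p : Fin (suc n)) → numEssential (h ∘ select (punchIn p)) ≡ numEssential h
numEssential-dummy {n} h p =
  trans (cong ∣_∣ (insertAt-unique (essentials G) p (lookup-ext off-p) at-p)) (∣insertAt∣ (essentials h) p false)
  where
  G : BF (suc n)
  G = h ∘ select (punchIn p)
  at-p : lookup (essentials G) p ≡ false
  at-p = trans (lookup∘tabulate (does ∘ essential? G) p) (dec-false (essential? G p) (essential-outside h (punchInᵢ≢i p)))
  off-p : ∀ t → lookup (select (punchIn p) (essentials G)) t ≡ lookup (essentials h) t
  off-p t = begin
    lookup (select (punchIn p) (essentials G)) t ≡⟨ lookup-select (punchIn p) (essentials G) t ⟩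
    lookup (essentials G) (punchIn p t)          ≡⟨ lookup∘tabulate (does ∘ essential? G) (punchIn p t) ⟩
    does (essential? G (punchIn p t))            ≡⟨ does-⇔ (essential-select h (punchIn-injective p _ _) t)
                                                              (essential? G (punchIn p t)) (essential? h t) ⟩
    does (essential? h t)                        ≡⟨ lookup∘tabulate (does ∘ essential? h) t ⟨
    lookup (essentials h) t                      ∎
    where open ≡-Reasoning

numEssential⇔ : {f : BF n} {m : ℕ} → NumEssential f m ⇔ (numEssential f ≡ m)
numEssential⇔ {f = f} = mk⇔ forward backward
  where
  forward : ∀ {m} → NumEssential f m → numEssential f ≡ m
  forward (S , ∣S∣≡m , S⇔ess) = trans (cong ∣_∣ (⊆-antisym E⊆S S⊆E)) ∣S∣≡m
    where
    E⊆S : essentials f ⊆ S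
    E⊆S {i} i∈E = proj₂ (S⇔ess i) (to (∈-essentials f i) i∈E)
    S⊆E : S ⊆ essentials f
    S⊆E {i} i∈S = from (∈-essentials f i) (proj₁ (S⇔ess i) i∈S)
  backward : ∀ {m} → numEssential f ≡ m → NumEssential f m
  backward #f = essentials f , #f , λ i → to (∈-essentials f i) , from (∈-essentials f i)

inessential⇔numEssential≡0 : {f : BF n} → (∀ i → ¬ Essential f i) ⇔ (numEssential f ≡ 0)
inessential⇔numEssential≡0 {zero} = mk⇔ (λ _ → refl) (λ _ ())
inessential⇔numEssential≡0 {suc n} {f} = mk⇔ forward backward
  where
  forward : (∀ i → ¬ Essential f i) → numEssential f ≡ 0
  forward ¬ess = n≤0⇒n≡0 (subst (numEssential f ≤_) (∣⊥∣≡0 (suc n))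
    (∣∣-mono (essentials f) ∅ λ i i∈E → ⊥-elim (¬ess i (to (lookup-essentials f i) i∈E))))
  backward : numEssential f ≡ 0 → ∀ i → ¬ Essential f i
  backward #f≡0 i ess with trans (sym #f≡0) (numEssential-suc ess)
  ... | ()

depth≤numEssential : ∀ k {f : BF n} → Depth f k → k ≤ numEssential f
depth≤numEssential zero _ = z≤n
depth≤numEssential {zero} (suc k) ()
depth≤numEssential {suc n} (suc k) {f} (i , a , b , C , d) = begin
  suc k                                     ≤⟨ s≤s (depth≤numEssential k d) ⟩
  suc (numEssential (restrict f i (not a))) ≤⟨ s≤s (numEssential-restrict f i (not a)) ⟩
  suc ∣ removeAt (essentials f) i ∣          ≡⟨ numEssential-suc (canalizesAt-essential C) ⟨
  numEssential f                            ∎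
  where open ≤-Reasoning

-- Enumerations of Boolean functions up to pointwise equality
record Enumeration (n : ℕ) (P : BF n → Set) (c : ℕ) : Set where
  field
    enum     : Fin c → BF n
    sound    : ∀ i → P (enum i)
    distinct : ∀ i j → enum i ≗ᴮ enum j → i ≡ j
    complete : ∀ f → P f → ∃[ i ] f ≗ᴮ enum i

fromCount : {P : BF n → Set} {c : ℕ} → Count n P c → Enumeration n P c
fromCount (L , sound , distinct , complete) = record { enum = lookup L ; sound = sound ; distinct = distinct ; complete = complete }

module _ {P Q : BF n → Set} {c : ℕ} (E : Enumeration n P c) where
  open Enumeration E

  enumeration-≤ : {d : ℕ} → Enumeration n Q d → (∀ {f} → P f → Q f) → c ≤ d
  enumeration-≤ {d} E′ P⇒Q = injective⇒≤ {f = index} index-injective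
    where
    open Enumeration E′ using () renaming (enum to enum′; complete to complete′)
    index : Fin c → Fin d
    index i = proj₁ (complete′ (enum i) (P⇒Q (sound i)))
    index-injective : Injective _≡_ _≡_ index
    index-injective {i} {j} eq = distinct i j λ x → begin
      enum i x         ≡⟨ proj₂ (complete′ (enum i) (P⇒Q (sound i))) x ⟩
      enum′ (index i) x ≡⟨ cong (λ t → enum′ t x) eq ⟩
      enum′ (index j) x ≡⟨ proj₂ (complete′ (enum j) (P⇒Q (sound j))) x ⟨
      enum j x         ∎
      where open ≡-Reasoning

  enumeration-cong : (∀ {f} → P f ⇔ Q f) → Enumeration n Q c
  enumeration-cong P⇔Q = record
    { enum = enum ; sound = to P⇔Q ∘ sound ; distinct = distinct ; complete = λ f → complete f ∘ from P⇔Q }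

enumeration-unique : {P Q : BF n → Set} {c d : ℕ} →
                     Enumeration n P c → Enumeration n Q d → (∀ {f} → P f ⇔ Q f) → c ≡ d
enumeration-unique E E′ P⇔Q = ≤-antisym (enumeration-≤ E E′ (to P⇔Q)) (enumeration-≤ E′ E (from P⇔Q))

enumeration-empty : {P : BF n → Set} {c : ℕ} → Enumeration n P c → (∀ {f} → ¬ P f) → c ≡ 0
enumeration-empty {c = zero} E ¬P = refl
enumeration-empty {c = suc c} E ¬P = ⊥-elim (¬P (Enumeration.sound E zero))

record Partition (c : ℕ) (D₁ D₂ : Fin c → Set) : Set where
  field
    {size₁ size₂} : ℕ
    ι₁ : Fin size₁ → Fin c
    ι₂ : Fin size₂ → Fin c
    ι₁-injective : Injective _≡_ _≡_ ι₁
    ι₂-injective : Injective _≡_ _≡_ ι₂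
    ι₁-sound : ∀ i → D₁ (ι₁ i)
    ι₂-sound : ∀ i → D₂ (ι₂ i)
    cover : ∀ t → (∃[ i ] ι₁ i ≡ t) ⊎ (∃[ i ] ι₂ i ≡ t)
    size : size₁ + size₂ ≡ c

partition-swap : {c : ℕ} {D₁ D₂ : Fin c → Set} → Partition c D₁ D₂ → Partition c D₂ D₁
partition-swap π = record
  { ι₁ = ι₂ ; ι₂ = ι₁ ; ι₁-injective = ι₂-injective ; ι₂-injective = ι₁-injective
  ; ι₁-sound = ι₂-sound ; ι₂-sound = ι₁-sound ; cover = swap ∘ cover ; size = trans (+-comm size₂ size₁) size }
  where open Partition π

partition-cons : {c : ℕ} {D₁ D₂ : Fin (suc c) → Set} →
                 D₁ zero → Partition c (D₁ ∘ suc) (D₂ ∘ suc) → Partition (suc c) D₁ D₂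
partition-cons {D₁ = D₁} d π = record
  { ι₁ = lift 1 ι₁ ; ι₂ = suc ∘ ι₂
  ; ι₁-injective = lift-injective ι₁ ι₁-injective 1 ; ι₂-injective = ι₂-injective ∘ Fin-suc-injective
  ; ι₁-sound = sound₁ ; ι₂-sound = ι₂-sound ; cover = cover′ ; size = cong suc size }
  where
  open Partition π
  sound₁ : ∀ i → D₁ (lift 1 ι₁ i)
  sound₁ zero = d
  sound₁ (suc i) = ι₁-sound i
  cover′ : ∀ t → (∃[ i ] lift 1 ι₁ i ≡ t) ⊎ (∃[ i ] suc (ι₂ i) ≡ t)
  cover′ zero = inj₁ (zero , refl)
  cover′ (suc t) with cover t
  ... | inj₁ (i , refl) = inj₁ (suc i , refl)
  ... | inj₂ (i , refl) = inj₂ (i , refl)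

partition : (c : ℕ) {D : Fin c → Set} → (∀ t → Dec (D t)) → Partition c D (¬_ ∘ D)
partition zero D? = record
  { size₁ = 0 ; size₂ = 0 ; ι₁ = λ () ; ι₂ = λ () ; ι₁-injective = λ {} ; ι₂-injective = λ {}
  ; ι₁-sound = λ () ; ι₂-sound = λ () ; cover = λ () ; size = refl }
partition (suc c) D? with D? zero | partition c (D? ∘ suc)
... | yes d | π = partition-cons d π
... | no ¬d | π = partition-swap (partition-cons ¬d (partition-swap π))

module _ {P : BF n → Set} {c : ℕ} (E : Enumeration n P c) where
  open Enumeration E

  subEnumeration : {R : BF n → Set} → (∀ {f g} → f ≗ᴮ g → R f → R g) →
    {c′ : ℕ} (ι : Fin c′ → Fin c) → Injective _≡_ _≡_ ι → (∀ i → R (enum (ι i))) →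
    (∀ t → R (enum t) → ∃[ i ] ι i ≡ t) → Enumeration n (λ f → P f × R f) c′
  subEnumeration {R} R-resp ι ι-injective ι-sound ι-cover = record
    { enum = enum ∘ ι ; sound = λ i → sound (ι i) , ι-sound i
    ; distinct = λ i j → ι-injective ∘ distinct (ι i) (ι j) ; complete = complete′ }
    where
    complete′ : ∀ f → P f × R f → ∃[ i ] f ≗ᴮ enum (ι i)
    complete′ f (p , r) with complete f p
    ... | t , f≗ with ι-cover t (R-resp f≗ r)
    ...   | i , refl = i , f≗

  enumeration-split : {Q : BF n → Set} → (∀ f → Dec (Q f)) → (∀ {f g} → f ≗ᴮ g → Q f → Q g) →
    ∃₂ λ c₁ c₂ → Enumeration n (λ f → P f × Q f) c₁ × Enumeration n (λ f → P f × ¬ Q f) c₂ × c₁ + c₂ ≡ c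
  enumeration-split {Q} Q? Q-resp =
    size₁ , size₂ ,
    subEnumeration Q-resp ι₁ ι₁-injective ι₁-sound cover₁ ,
    subEnumeration ¬Q-resp ι₂ ι₂-injective ι₂-sound cover₂ ,
    size
    where
    open Partition (partition c (Q? ∘ enum))
    ¬Q-resp : ∀ {f g} → f ≗ᴮ g → ¬ Q f → ¬ Q g
    ¬Q-resp f≗g ¬q = ¬q ∘ Q-resp (sym ∘ f≗g)
    cover₁ : ∀ t → Q (enum t) → ∃[ i ] ι₁ i ≡ t
    cover₁ t q with cover t
    ... | inj₁ hit = hit
    ... | inj₂ (i , refl) = ⊥-elim (ι₂-sound i q)
    cover₂ : ∀ t → ¬ Q (enum t) → ∃[ i ] ι₂ i ≡ t
    cover₂ t ¬q with cover t
    ... | inj₁ (i , refl) = ⊥-elim (¬q (ι₁-sound i))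
    ... | inj₂ hit = hit

module _ {P : ∀ {n} → BF n → Set} (P-resp : ∀ {n} {f g : BF n} → f ≗ᴮ g → P f → P g)
         {p : Fin (suc n)} (P-dummy : ∀ {h : BF n} → P (h ∘ select (punchIn p)) ⇔ P h) where

  enumeration-removeDummy : {c : ℕ} → Enumeration (suc n) (λ f → P f × ¬ Essential f p) c → Enumeration n P c
  enumeration-removeDummy {c} E = record { enum = enum′ ; sound = sound′ ; distinct = distinct′ ; complete = complete′ }
    where
    open Enumeration E
    enum′ : Fin c → BF n
    enum′ i = restrict (enum i) p false
    factors : ∀ i → enum i ≗ᴮ (enum′ i ∘ select (punchIn p))
    factors i = inessential-factors (proj₂ (sound i)) false
    sound′ : ∀ i → P (enum′ i)
    sound′ i = to P-dummy (P-resp (factors i) (proj₁ (sound i)))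
    distinct′ : ∀ i j → enum′ i ≗ᴮ enum′ j → i ≡ j
    distinct′ i j eq = distinct i j λ x → trans (factors i x) (trans (eq _) (sym (factors j x)))
    complete′ : ∀ h → P h → ∃[ i ] h ≗ᴮ enum′ i
    complete′ h Ph with complete (h ∘ select (punchIn p)) (from P-dummy Ph , essential-outside h (punchInᵢ≢i p))
    ... | i , eq = i , λ y → trans (cong h (sym (select-punchIn-insertAt y p false))) (eq (insertAt y p false))

-- Counting by essential variables
FirstEssential : ℕ → BF n → Set
FirstEssential j f = ∀ t → toℕ t < j → Essential f t

toℕ-punchIn-< : (p : Fin (suc n)) (t : Fin n) → toℕ t < toℕ p → toℕ (punchIn p t) ≡ toℕ t
toℕ-punchIn-< (suc p) zero _ = refl
toℕ-punchIn-< (suc p) (suc t) (s≤s t<p) = cong suc (toℕ-punchIn-< p t t<p)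

punchIn-below : (p t : Fin (suc n)) → toℕ t < toℕ p → ∃[ t′ ] punchIn p t′ ≡ t × toℕ t′ ≡ toℕ t
punchIn-below {suc n} (suc p) zero _ = zero , refl , refl
punchIn-below {suc n} (suc p) (suc t) (s≤s t<p) with punchIn-below p t t<p
... | t′ , refl , eq = suc t′ , refl , cong suc eq

module _ {j : ℕ} {p : Fin (suc n)} (p≡j : toℕ p ≡ j) where

  firstEssential-dummy : {h : BF n} → FirstEssential j (h ∘ select (punchIn p)) ⇔ FirstEssential j h
  firstEssential-dummy {h} = mk⇔ forward backward
    where
    forward : FirstEssential j (h ∘ select (punchIn p)) → FirstEssential j h
    forward first t t<j = to (essential-select h (punchIn-injective p _ _) t)
      (first (punchIn p t) (subst (_< j) (sym (toℕ-punchIn-< p t (subst (toℕ t <_) (sym p≡j) t<j))) t<j))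
    backward : FirstEssential j h → FirstEssential j (h ∘ select (punchIn p))
    backward first t t<j with punchIn-below p t (subst (toℕ t <_) (sym p≡j) t<j)
    ... | t′ , refl , eq = from (essential-select h (punchIn-injective p _ _) t′) (first t′ (subst (_< j) (sym eq) t<j))

  firstEssential-suc : {f : BF (suc n)} → FirstEssential (suc j) f ⇔ (FirstEssential j f × Essential f p)
  firstEssential-suc {f} = mk⇔
    (λ first → (λ t t<j → first t (m<n⇒m<1+n t<j)) , first p (s≤s (≤-reflexive p≡j)))
    backward
    where
    backward : FirstEssential j f × Essential f p → FirstEssential (suc j) f
    backward (first , ess) t (s≤s t≤j) with toℕ t ≟ j
    ... | yes t≡j = subst (Essential f) (toℕ-injective (trans p≡j (sym t≡j))) ess
    ... | no t≢j = first t (≤∧≢⇒< t≤j t≢j)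

numEssential-first : {f : BF n} {j : ℕ} → j ≤ n → FirstEssential j f → j ≤ numEssential f
numEssential-first {f = f} {j} j≤n first = ∣∣-prefix (essentials f) j j≤n λ t t<j → from (lookup-essentials f t) (first t t<j)

numEssential≡n⇒essential : {f : BF n} → numEssential f ≡ n → ∀ t → Essential f t
numEssential≡n⇒essential {n} {f} all t =
  to (lookup-essentials f t) (trans (cong (λ S → lookup S t) (∣p∣≡n⇒p≡⊤ {p = essentials f} all)) (lookup-replicate t true))

WithEssentials : ℕ → (BF n → Set) → BF n → Set
WithEssentials m P f = numEssential f ≡ m × P f

module _ {P : ∀ {n} → BF n → Set} (P-inv : SelectInvariant P) where

  private
    P-cong : {f g : BF n} → f ≗ᴮ g → P f ⇔ P g
    P-cong {g = g} f≗g = P-inv (λ eq → eq) λ x → trans (f≗g x) (cong g (sym (select-id x)))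

    Q : ℕ → ℕ → BF n → Set
    Q m j f = WithEssentials m P f × FirstEssential j f

    Q-resp : ∀ m j {f g : BF n} → f ≗ᴮ g → Q m j f → Q m j g
    Q-resp m j f≗g ((#f , Pf) , first) =
      (trans (sym (numEssential-cong f≗g)) #f , to (P-cong f≗g) Pf) , λ t t<j → essential-cong f≗g (first t t<j)

    Q-dummy : ∀ m j {p : Fin (suc n)} → toℕ p ≡ j → {h : BF n} → Q m j (h ∘ select (punchIn p)) ⇔ Q m j h
    Q-dummy m j {p} p≡j {h} =
      (≡-cong (numEssential-dummy h p) ×-⇔ P-inv (punchIn-injective p _ _) (λ _ → refl)) ×-⇔ firstEssential-dummy p≡j
      where
      ≡-cong : ∀ {a b c : ℕ} → a ≡ b → (a ≡ c) ⇔ (b ≡ c)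
      ≡-cong a≡b = mk⇔ (trans (sym a≡b)) (trans a≡b)

    boundary : ∀ r j → Fin (suc (r + j))
    boundary r j = fromℕ< (s≤s (m≤n+m j r))

    toℕ-boundary : ∀ r j → toℕ (boundary r j) ≡ j
    toℕ-boundary r j = toℕ-fromℕ< (s≤s (m≤n+m j r))

    deleteBoundary : ∀ {r j m c} → Enumeration (suc (r + j)) (λ f → Q m j f × ¬ Essential f (boundary r j)) c →
                     Enumeration (r + j) (Q m j) c
    deleteBoundary {r} {j} {m} = enumeration-removeDummy {P = Q m j} (Q-resp m j) (Q-dummy m j (toℕ-boundary r j))

    extendBoundary : ∀ {r j m c} → Enumeration (suc (r + j)) (λ f → Q m j f × Essential f (boundary r j)) c →
                     Enumeration (suc (r + j)) (Q m (suc j)) c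
    extendBoundary {r} {j} E = enumeration-cong E (mk⇔
      (λ ((w , first) , ess) → w , from extend (first , ess))
      (λ (w , first) → (w , proj₁ (to extend first)) , proj₂ (to extend first)))
      where
      extend : ∀ {f} → FirstEssential (suc j) f ⇔ (FirstEssential j f × Essential f (boundary r j))
      extend = firstEssential-suc (toℕ-boundary r j)

    boundary-inessential : ∀ {r j} {f : BF (suc (r + j))} → Q j j f → ¬ Essential f (boundary r j)
    boundary-inessential {r} {j} ((#f , _) , first) ess = n≮n j (subst (suc j ≤_) #f
      (numEssential-first (s≤s (m≤n+m j r)) (from (firstEssential-suc (toℕ-boundary r j)) (first , ess))))

    count : ∀ r d {n j m c c′} → r + j ≡ n → d + j ≡ m →
            Enumeration n (Q m j) c → Enumeration m (WithEssentials m P) c′ → c ≡ (r C d) * c′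
    count zero zero refl refl E E′ =
      trans (enumeration-unique E E′ (mk⇔ proj₁ λ w → w , λ t _ → numEssential≡n⇒essential (proj₁ w) t))
            (sym (+-identityʳ _))
    count zero (suc d) {j = j} refl refl E E′ =
      enumeration-empty E λ ((#f , _) , _) → m+n≮n d j (subst (_≤ j) #f (numEssential≤n _))
    count (suc r) zero refl refl E E′ =
      count r zero refl refl (deleteBoundary (enumeration-cong E (mk⇔ (λ q → q , boundary-inessential q) proj₁))) E′
    count (suc r) (suc d) {j = j} {c = c} {c′} refl refl E E′
      with enumeration-split E (λ f → essential? f (boundary r j)) (λ f≗g → essential-cong f≗g)
    ... | c₁ , c₂ , E₁ , E₂ , c₁+c₂≡c = begin
      c                                 ≡⟨ c₁+c₂≡c ⟨
      c₁ + c₂                           ≡⟨ cong₂ _+_ (count r d (+-suc r j) (+-suc d j) (extendBoundary E₁) E′)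
                                                     (count r (suc d) refl refl (deleteBoundary E₂) E′) ⟩
      (r C d) * c′ + (r C suc d) * c′   ≡⟨ *-distribʳ-+ c′ (r C d) (r C suc d) ⟨
      (r C d + r C suc d) * c′          ≡⟨ cong (_* c′) (nCk+nC[k+1]≡[n+1]C[k+1] r d) ⟩
      (suc r C suc d) * c′              ∎
      where open ≡-Reasoning

  numEssential-binomial : {c c′ : ℕ} → Enumeration n (WithEssentials m P) c → Enumeration m (WithEssentials m P) c′ →
                          c ≡ (n C m) * c′
  numEssential-binomial {n} {m} E E′ =
    count n m (+-identityʳ n) (+-identityʳ m) (enumeration-cong E (mk⇔ (_, λ _ ()) proj₁)) E′

sum-upTo-suc : (g : ℕ → ℕ) (j : ℕ) → sum (map g (upTo (suc j))) ≡ sum (map g (upTo j)) + g j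
sum-upTo-suc g j = begin
  sum (map g (upTo (suc j)))             ≡⟨ cong (sum ∘ map g) (upTo-∷ʳ j) ⟨
  sum (map g (upTo j ++ [ j ]))          ≡⟨ cong sum (map-++ g (upTo j) [ j ]) ⟩
  sum (map g (upTo j) ++ [ g j ])        ≡⟨ sum-++ (map g (upTo j)) [ g j ] ⟩
  sum (map g (upTo j)) + (g j + 0)       ≡⟨ cong (sum (map g (upTo j)) +_) (+-identityʳ (g j)) ⟩
  sum (map g (upTo j)) + g j             ∎
  where open ≡-Reasoning

numEssential-sum : {P : BF n → Set} {c : ℕ} (N : ℕ → ℕ) → (∀ i → i ≤ n → Enumeration n (WithEssentials i P) (N i)) →
                   Enumeration n P c → c ≡ sum (map N (upTo n)) + N n
numEssential-sum {n} {P} {c} N Eᵢ E = begin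
  c                          ≡⟨ partial (suc n) ≤-refl (enumeration-cong E (mk⇔ (λ p → p , s≤s (numEssential≤n _)) proj₁)) ⟩
  sum (map N (upTo (suc n))) ≡⟨ sum-upTo-suc N n ⟩
  sum (map N (upTo n)) + N n ∎
  where
  open ≡-Reasoning
  partial : ∀ j {c} → j ≤ suc n → Enumeration n (λ f → P f × numEssential f < j) c → c ≡ sum (map N (upTo j))
  partial zero _ E′ = enumeration-empty E′ λ (_ , #f<0) → n≮0 #f<0
  partial (suc j) {c} (s≤s j≤n) E′ with enumeration-split E′ (λ f → numEssential f ≟ j) (λ f≗g → trans (sym (numEssential-cong f≗g)))
  ... | c₁ , c₂ , E₁ , E₂ , c₁+c₂≡c = begin
    c                               ≡⟨ c₁+c₂≡c ⟨
    c₁ + c₂                         ≡⟨ +-comm c₁ c₂ ⟩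
    c₂ + c₁                         ≡⟨ cong₂ _+_ (partial j (m≤n⇒m≤1+n j≤n) E₂′) c₁≡Nj ⟩
    sum (map N (upTo j)) + N j      ≡⟨ sum-upTo-suc N j ⟨
    sum (map N (upTo (suc j)))      ∎
    where
    c₁≡Nj : c₁ ≡ N j
    c₁≡Nj = enumeration-unique E₁ (Eᵢ j j≤n) (mk⇔ (λ ((p , _) , #f) → #f , p) λ (#f , p) → (p , s≤s (≤-reflexive #f)) , #f)
    E₂′ : Enumeration n (λ f → P f × numEssential f < j) c₂
    E₂′ = enumeration-cong E₂ (mk⇔ (λ ((p , #f<sj) , #f≢j) → p , ≤∧≢⇒< (≤-pred #f<sj) #f≢j)
                                   λ (p , #f<j) → (p , m<n⇒m<1+n #f<j) , <⇒≢ #f<j)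

constantFunctions : Enumeration n (WithEssentials 0 (λ f → Depth f 0)) 2
constantFunctions {n} = record { enum = constant ; sound = sound ; distinct = distinct ; complete = complete }
  where
  value : Fin 2 → Bool
  value zero = true
  value (suc zero) = false
  constant : Fin 2 → BF n
  constant i _ = value i
  sound : ∀ i → WithEssentials 0 (λ f → Depth f 0) (constant i)
  sound i = to (inessential⇔numEssential≡0 {f = constant i}) (λ _ (_ , ≢) → ≢ refl) ,
            λ can → proj₂ (canalization-≢const can (value i)) refl
  distinct : ∀ i j → constant i ≗ᴮ constant j → i ≡ j
  distinct zero zero _ = refl
  distinct (suc zero) (suc zero) _ = refl
  distinct zero (suc zero) eq with eq (replicate n false)
  ... | ()
  distinct (suc zero) zero eq with eq (replicate n false)
  ... | ()
  complete : ∀ f → WithEssentials 0 (λ f → Depth f 0) f → ∃[ i ] f ≗ᴮ constant i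
  complete f (#f≡0 , _) with f (replicate n false) in fx₀
  ... | true = zero , λ x → trans (inessential⇒constant (from inessential⇔numEssential≡0 #f≡0) x _) fx₀
  ... | false = suc zero , λ x → trans (inessential⇒constant (from inessential⇔numEssential≡0 #f≡0) x _) fx₀

theorem2 : (N : ℕ → ℕ → ℕ → ℕ) (Cd : ℕ → ℕ → ℕ)
    → (∀ n m k → m ≤ n → k ≤ n → Count n (λ f → NumEssential f m × CanalizingDepth f k) (N n m k))
    → (∀ n k → k ≤ n → Count n (λ f → CanalizingDepth f k) (Cd n k))
    → ∀ n m k → m ≤ n → k ≤ n
    → (m < k → N n m k ≡ 0)
      × (m ≡ 0 → k ≡ 0 → N n m k ≡ 2)
      × (k ≤ m → m < n → N n m k ≡ (n C m) * N m m k)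
      × (m ≡ n → N n m k ≡ Cd n k ∸ sum (map (λ i → N n i k) (upTo n)))
theorem2 N Cd hN hC n m k m≤n k≤n =
  (λ m<k → enumeration-empty (Nₑ n m k m≤n k≤n) λ (#f , d) → <⇒≱ m<k (subst (k ≤_) #f (depth≤numEssential k d))) ,
  (λ { refl refl → enumeration-unique (Nₑ n 0 0 z≤n z≤n) constantFunctions (⇔-id _) }) ,
  (λ k≤m _ → numEssential-binomial (depth-invariant k) (Nₑ n m k m≤n k≤n) (Nₑ m m k ≤-refl k≤m)) ,
  (λ { refl → begin
    N n n k             ≡⟨ m+n∸m≡n S (N n n k) ⟨
    S + N n n k ∸ S     ≡⟨ cong (_∸ S) (numEssential-sum (λ i → N n i k) (λ i i≤n → Nₑ n i k i≤n k≤n) Cₑ) ⟨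
    Cd n k ∸ S          ∎ })
  where
  open ≡-Reasoning
  Nₑ : ∀ n m k → m ≤ n → k ≤ n → Enumeration n (WithEssentials m (λ f → Depth f k)) (N n m k)
  Nₑ n m k m≤n k≤n = enumeration-cong (fromCount (hN n m k m≤n k≤n)) (numEssential⇔ ×-⇔ canalizingDepth⇔depth k)
  Cₑ : Enumeration n (λ f → Depth f k) (Cd n k)
  Cₑ = enumeration-cong (fromCount (hC n k k≤n)) (canalizingDepth⇔depth k)
  S : ℕ
  S = sum (map (λ i → N n i k) (upTo n))
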